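{- Let $h(x)=a_kx^k+\cdots+a_1x+a_0\in\mathbb{Z}[x]$ with $a_k>0$, and let $R=(|a_0|+\cdots+|a_{k-1}|)/a_k$. Then for every real $x>0$, $$\left|\{n\in\mathbb{N}:0<h(n)<x\}\ \triangle\ [1,(x/a_k)^{1/k}]\right|\leq 3\lfloor R\rfloor+2,$$ where $\triangle$ denotes symmetric difference and $[1,y]$ denotes the set of integers $n$ with $1\leq n\leq y$.
   Context: $\mathbb{N}=\{1,2,3,\dots\}$.
   Formalization: The variable x ranges over the positive rationals instead of the positive reals. -}

module Defs where

open import Data.Nat as ℕ using (ℕ; zero; suc)
open import Data.Nat.DivMod as ℕD
open import Data.Fin using (Fin; zero; suc; toℕ)
open import Data.Integer as ℤ using (ℤ; +_)
open import Data.Rational as ℚ using (ℚ)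
open import Data.Bool using (Bool; true; false; _xor_)
open import Data.List using (List)
open import Data.List.Relation.Unary.All using (All)
open import Data.List.Relation.Unary.Unique.Propositional using (Unique)
open import Relation.Nullary.Decidable using (⌊_⌋)

sumℤ : ∀ {k} → (Fin k → ℤ) → ℤ
sumℤ {zero}  f = + 0
sumℤ {suc k} f = f zero ℤ.+ sumℤ (λ i → f (suc i))

sumℕ : ∀ {k} → (Fin k → ℕ) → ℕ
sumℕ {zero}  f = 0
sumℕ {suc k} f = f zero ℕ.+ sumℕ (λ i → f (suc i))

-- h(n) = c n^k + a_{k-1} n^{k-1} + ... + a_0, with lower coefficients a : Fin k → ℤ
-- (a i = a_i) and leading coefficient a_k = c.
poly : (k : ℕ) (c : ℕ) (a : Fin k → ℤ) → ℕ → ℤ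
poly k c a n = (+ c) ℤ.* (+ n) ℤ.^ k ℤ.+ sumℤ (λ i → a i ℤ.* (+ n) ℤ.^ toℕ i)

floorR : (k : ℕ) (c : ℕ) .{{_ : ℕ.NonZero c}} (a : Fin k → ℤ) → ℕ
floorR k c a = sumℕ (λ i → ℤ.∣ a i ∣) ℕD./ c

InA : (k c : ℕ) (a : Fin k → ℤ) (x : ℚ) (n : ℕ) → Set
InA k c a x n = (1 ℕ.≤ n) Data.Product.× ((+ 0 ℤ.< poly k c a n) Data.Product.× (poly k c a n ℚ./ 1 ℚ.< x))
  where import Data.Product

-- membership of n in [1, (x/a_k)^{1/k}]: 1 ≤ n and n^k ≤ x / a_k, i.e. a_k n^k ≤ x
InB : (k c : ℕ) (x : ℚ) (n : ℕ) → Set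
InB k c x n = (1 ℕ.≤ n) Data.Product.× (((+ c) ℤ.* (+ n) ℤ.^ k) ℚ./ 1 ℚ.≤ x)
  where import Data.Product

InSymDiff : (k c : ℕ) (a : Fin k → ℤ) (x : ℚ) (n : ℕ) → Set
InSymDiff k c a x n =
  (InA k c a x n Data.Product.× (InB k c x n → Data.Empty.⊥)) Data.Sum.⊎
  (InB k c x n Data.Product.× (InA k c a x n → Data.Empty.⊥))
  where import Data.Product; import Data.Sum; import Data.Empty

CardLe : (ℕ → Set) → ℕ → Set
CardLe S b = (l : List ℕ) → Unique l → All S l → Data.List.length l ℕ.≤ b
  where import Data.List

{-# OPTIONS --safe #-}
-- Write h(n) = c nᵏ + L(n) and S = |a₀| + ⋯ + |aₖ₋₁|. For n ≥ 1, |L(n)| ≤ S nᵏ⁻¹ < (r + 1) c nᵏ⁻¹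
-- with r = ⌊S/c⌋, hence c (n − r − 1)ᵏ < h(n) < c (n + r + 1)ᵏ. Let N be the largest integer with
-- c Nᵏ ≤ x, so that [1, (x/c)^{1/k}] = [1, N]. A point n of A ∖ B has n > N, and h(n) < x < c (N + 1)ᵏ
-- forces n ≤ N + r + 1. A point n of B ∖ A has n ≤ N and either h(n) ≤ 0, which forces n ≤ r, or
-- h(n) ≥ x ≥ c Nᵏ, which forces n ≥ N − r. These three windows hold r + 1, r and r + 1 integers.
module Submission where

open import Defs
open import Data.Nat using (ℕ; NonZero; _≤_; _+_; _*_)
open import Data.Fin using (Fin)
open import Data.Integer using (ℤ)
open import Data.Rational using (ℚ; 0ℚ; _<_)

open import Data.Nat as ℕ using (zero; suc; z≤n; s≤s; _∸_; _^_; >-nonZero; >-nonZero⁻¹)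
open import Data.Nat.Properties
import Data.Nat.DivMod as ℕ
open import Data.Nat.Solver using (module +-*-Solver)
open import Data.Nat.Coprimality as Coprime using (1-coprimeTo)
open import Data.Fin using (toℕ; zero; suc)
import Data.Fin.Properties as Fin
open import Data.Integer as ℤ using (+_; -[1+_]; ∣_∣)
import Data.Integer.Properties as ℤ
open import Data.Rational as ℚ using (mkℚ; *≤*; *<*)
import Data.Rational.Properties as ℚ
open import Data.List using (List; []; _∷_; length; filter)
open import Data.List.Relation.Unary.All as All using (All; _∷_)
import Data.List.Relation.Unary.All.Properties as All
import Data.List.Relation.Unary.Unique.Propositional.Properties as Unique
open import Data.List.Relation.Unary.AllPairs using (_∷_)
open import Data.Product using (_×_; _,_; proj₁; proj₂; ∃-syntax)
open import Data.Sum using (inj₁; inj₂)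
open import Data.Empty using (⊥-elim)
open import Relation.Nullary using (¬_; yes; no)
open import Relation.Nullary.Decidable using (_×-dec_)
open import Relation.Unary using (Pred; Decidable; _⊆_; _∪_)
open import Relation.Unary.Properties using (∁?)
open import Relation.Binary.PropositionalEquality using (_≡_; refl; sym; trans; cong; subst)

length-filter+length-filter-∁ : ∀ {a p} {A : Set a} {P : Pred A p} (P? : Decidable P) (xs : List A) →
  length (filter P? xs) + length (filter (∁? P?) xs) ≡ length xs
length-filter+length-filter-∁ P? [] = refl
length-filter+length-filter-∁ P? (x ∷ xs) with P? x
... | yes _ = cong suc (length-filter+length-filter-∁ P? xs)
... | no _ = trans (+-suc _ _) (cong suc (length-filter+length-filter-∁ P? xs))

CardLe-⊆ : ∀ {P Q : Pred ℕ _} {b} → P ⊆ Q → CardLe Q b → CardLe P b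
CardLe-⊆ P⊆Q card l u ps = card l u (All.map P⊆Q ps)

CardLe-≤ : ∀ {P : Pred ℕ _} {b b′} → b ≤ b′ → CardLe P b → CardLe P b′
CardLe-≤ b≤b′ card l u ps = ≤-trans (card l u ps) b≤b′

CardLe-∪ : ∀ {P Q : Pred ℕ _} {b b′} → Decidable P → CardLe P b → CardLe Q b′ →
  CardLe (P ∪ Q) (b + b′)
CardLe-∪ {P} {Q} {b} {b′} P? cardP cardQ l u ps = begin
  length l
    ≡⟨ sym (length-filter+length-filter-∁ P? l) ⟩
  length (filter P? l) + length (filter (∁? P?) l)
    ≤⟨ +-mono-≤ (cardP _ (Unique.filter⁺ P? u) (All.all-filter P? l))
                (cardQ _ (Unique.filter⁺ (∁? P?) u) onlyQ) ⟩
  b + b′ ∎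
  where
  open ≤-Reasoning
  ¬P⇒Q : ∀ {n} → (P ∪ Q) n × ¬ P n → Q n
  ¬P⇒Q (inj₁ p , ¬p) = ⊥-elim (¬p p)
  ¬P⇒Q (inj₂ q , _)  = q
  onlyQ : All Q (filter (∁? P?) l)
  onlyQ = All.map ¬P⇒Q (All.zip (All.filter⁺ (∁? P?) ps , All.all-filter (∁? P?) l))

CardLe-singleton : ∀ m → CardLe (_≡ m) 1
CardLe-singleton m []          _               _                 = z≤n
CardLe-singleton m (_ ∷ [])    _               _                 = ≤-refl
CardLe-singleton m (_ ∷ _ ∷ _) ((x≢y ∷ _) ∷ _) (refl ∷ refl ∷ _) = ⊥-elim (x≢y refl)

Interval : ℕ → ℕ → Pred ℕ _
Interval lo len n = lo ≤ n × n ℕ.< lo + len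

Interval? : ∀ lo len → Decidable (Interval lo len)
Interval? lo len n = lo ≤? n ×-dec n <? lo + len

Interval-suc : ∀ lo len → Interval lo (suc len) ⊆ (_≡ lo + len) ∪ Interval lo len
Interval-suc lo len {n} (lo≤n , n<lo+1+len) with n ≟ lo + len
... | yes n≡lo+len = inj₁ n≡lo+len
... | no  n≢lo+len =
  inj₂ (lo≤n , ≤∧≢⇒< (m<1+n⇒m≤n (subst (n ℕ.<_) (+-suc lo len) n<lo+1+len)) n≢lo+len)

CardLe-Interval : ∀ lo len → CardLe (Interval lo len) len
CardLe-Interval lo zero    []      _ _                       = z≤n
CardLe-Interval lo zero    (_ ∷ _) _ ((lo≤n , n<lo+0) ∷ _) =
  ⊥-elim (<⇒≱ n<lo+0 (≤-trans (≤-reflexive (+-identityʳ lo)) lo≤n))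
CardLe-Interval lo (suc len) = CardLe-⊆ (Interval-suc lo len)
  (CardLe-∪ (_≟ lo + len) (CardLe-singleton (lo + len)) (CardLe-Interval lo len))

Interval-below : ∀ {n m r} → n ≤ m → m ℕ.< n + suc r → Interval (m ∸ r) (suc r) n
Interval-below {n} {m} {r} n≤m m<n+1+r = m≤n+o⇒m∸n≤o m r m≤r+n , n<m∸r+1+r
  where
  open ≤-Reasoning
  m≤r+n : m ≤ r + n
  m≤r+n = begin
    m      ≤⟨ m<1+n⇒m≤n (subst (m ℕ.<_) (+-suc n r) m<n+1+r) ⟩
    n + r  ≡⟨ +-comm n r ⟩
    r + n  ∎
  n<m∸r+1+r : n ℕ.< m ∸ r + suc r
  n<m∸r+1+r = begin-strict
    n                ≤⟨ n≤m ⟩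
    m                ≤⟨ m≤n+m∸n m r ⟩
    r + (m ∸ r)      <⟨ n<1+n _ ⟩
    suc r + (m ∸ r)  ≡⟨ +-comm (suc r) (m ∸ r) ⟩
    m ∸ r + suc r    ∎

crossing : ∀ {p} {P : Pred ℕ p} → Decidable P → P 0 → ∀ b → ¬ P b → ∃[ n ] P n × ¬ P (suc n)
crossing P? P0 zero    ¬P0   = ⊥-elim (¬P0 P0)
crossing P? P0 (suc b) ¬Pb+1 with P? b
... | yes Pb  = b , Pb , ¬Pb+1
... | no  ¬Pb = crossing P? P0 b ¬Pb

m<[1+m/n]*n : ∀ m n .{{_ : NonZero n}} → m ℕ.< suc (m ℕ./ n) * n
m<[1+m/n]*n m n = begin-strict
  m                     ≡⟨ ℕ.m≡m%n+[m/n]*n m n ⟩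
  m ℕ.% n + m ℕ./ n * n  <⟨ +-monoˡ-< (m ℕ./ n * n) (ℕ.m%n<n m n) ⟩
  suc (m ℕ./ n) * n      ∎
  where open ≤-Reasoning

m≤n*m^[1+k] : ∀ m n .{{_ : NonZero n}} k → m ≤ n * m ^ suc k
m≤n*m^[1+k] zero      n k = z≤n
m≤n*m^[1+k] m@(suc _) n k = ≤-trans (m≤m*n m (m ^ k) {{m^n≢0 m k}}) (m≤n*m (m * m ^ k) n)

leading-term-dominates : ∀ {c S r} d {n} M .{{_ : NonZero M}} → S ℕ.< suc r * c → d + suc r ≤ n →
  c * (d * M) + S * M ℕ.< c * (n * M)
leading-term-dominates {c} {S} {r} d {n} M S<[1+r]c d+1+r≤n = begin-strict
  c * (d * M) + S * M          <⟨ +-monoʳ-< (c * (d * M)) (*-monoˡ-< M S<[1+r]c) ⟩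
  c * (d * M) + suc r * c * M  ≡⟨ solve 4 (λ c d s M → c :* (d :* M) :+ s :* c :* M := c :* ((d :+ s) :* M))
                                    refl c d (suc r) M ⟩
  c * ((d + suc r) * M)        ≤⟨ *-monoʳ-≤ c (*-monoˡ-≤ M d+1+r≤n) ⟩
  c * (n * M)                  ∎
  where open ≤-Reasoning; open +-*-Solver

i≤+∣i∣ : ∀ i → i ℤ.≤ + ∣ i ∣
i≤+∣i∣ (+ n)    = ℤ.≤-refl
i≤+∣i∣ -[1+ n ] = ℤ.-≤+

m+∣i∣≤n⇒+m≤+n+i : ∀ {m n} i → m + ∣ i ∣ ≤ n → + m ℤ.≤ + n ℤ.+ i
m+∣i∣≤n⇒+m≤+n+i {m} {n} (+ j) m+j≤n =
  subst (+ m ℤ.≤_) (ℤ.pos-+ n j) (ℤ.+≤+ (≤-trans (m+n≤o⇒m≤o m m+j≤n) (m≤m+n n j)))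
m+∣i∣≤n⇒+m≤+n+i {m} {n} -[1+ j ] m+1+j≤n =
  subst (+ m ℤ.≤_) (sym (ℤ.⊖-≥ (m+n≤o⇒n≤o m m+1+j≤n))) (ℤ.+≤+ (m+n≤o⇒m≤o∸n m m+1+j≤n))

+n+i≤+[n+∣i∣] : ∀ n i → + n ℤ.+ i ℤ.≤ + (n + ∣ i ∣)
+n+i≤+[n+∣i∣] n i = subst (+ n ℤ.+ i ℤ.≤_) (sym (ℤ.pos-+ n ∣ i ∣)) (ℤ.+-monoʳ-≤ (+ n) (i≤+∣i∣ i))

pos-^ : ∀ m n → (+ m) ℤ.^ n ≡ + (m ^ n)
pos-^ m zero    = refl
pos-^ m (suc n) = trans (cong (+ m ℤ.*_) (pos-^ m n)) (sym (ℤ.pos-* m (m ^ n)))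

∣sumℤ∣≤sumℕ∣∣ : ∀ {k} (f : Fin k → ℤ) → ∣ sumℤ f ∣ ≤ sumℕ (λ i → ∣ f i ∣)
∣sumℤ∣≤sumℕ∣∣ {zero}  f = z≤n
∣sumℤ∣≤sumℕ∣∣ {suc k} f =
  ≤-trans (ℤ.∣i+j∣≤∣i∣+∣j∣ (f zero) _) (+-monoʳ-≤ ∣ f zero ∣ (∣sumℤ∣≤sumℕ∣∣ (λ i → f (suc i))))

sumℕ-mono-≤ : ∀ {k} {f g : Fin k → ℕ} → (∀ i → f i ≤ g i) → sumℕ f ≤ sumℕ g
sumℕ-mono-≤ {zero}  f≤g = z≤n
sumℕ-mono-≤ {suc k} f≤g = +-mono-≤ (f≤g zero) (sumℕ-mono-≤ (λ i → f≤g (suc i)))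

sumℕ-distribʳ-* : ∀ {k} (f : Fin k → ℕ) m → sumℕ (λ i → f i * m) ≡ sumℕ f * m
sumℕ-distribʳ-* {zero}  f m = refl
sumℕ-distribʳ-* {suc k} f m =
  trans (cong (_+_ (f zero * m)) (sumℕ-distribʳ-* (λ i → f (suc i)) m)) (sym (*-distribʳ-+ m (f zero) _))

i/1≡mkℚi0 : ∀ i → i ℚ./ 1 ≡ mkℚ i 0 (Coprime.sym (1-coprimeTo ∣ i ∣))
i/1≡mkℚi0 i = ℚ.↥p/↧p≡p (mkℚ i 0 (Coprime.sym (1-coprimeTo ∣ i ∣)))

/1-mono-≤ : ∀ {i j} → i ℤ.≤ j → i ℚ./ 1 ℚ.≤ j ℚ./ 1
/1-mono-≤ {i} {j} i≤j rewrite i/1≡mkℚi0 i | i/1≡mkℚi0 j =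
  *≤* (ℤ.*-monoʳ-≤-nonNeg (+ 1) i≤j)

/1-mono-< : ∀ {i j} → i ℤ.< j → i ℚ./ 1 ℚ.< j ℚ./ 1
/1-mono-< {i} {j} i<j rewrite i/1≡mkℚi0 i | i/1≡mkℚi0 j =
  *<* (ℤ.*-monoʳ-<-pos (+ 1) i<j)

archimedean : ∀ p → ∃[ n ] p ℚ.< + n ℚ./ 1
archimedean p@(mkℚ i d _) =
  suc ∣ i ∣ , subst (p ℚ.<_) (sym (i/1≡mkℚi0 (+ suc ∣ i ∣))) (*<* i*1<[1+∣i∣]*[1+d])
  where
  open ℤ.≤-Reasoning
  i*1<[1+∣i∣]*[1+d] : i ℤ.* + 1 ℤ.< + suc ∣ i ∣ ℤ.* + suc d
  i*1<[1+∣i∣]*[1+d] = begin-strict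
    i ℤ.* + 1                ≡⟨ ℤ.*-identityʳ i ⟩
    i                        ≤⟨ i≤+∣i∣ i ⟩
    + ∣ i ∣                  <⟨ ℤ.+<+ (n<1+n ∣ i ∣) ⟩
    + suc ∣ i ∣              ≤⟨ ℤ.+≤+ (m≤m*n (suc ∣ i ∣) (suc d)) ⟩
    + (suc ∣ i ∣ * suc d)    ≡⟨ ℤ.pos-* (suc ∣ i ∣) (suc d) ⟩
    + suc ∣ i ∣ ℤ.* + suc d  ∎

∥_∥₁ : ∀ {k} → (Fin k → ℤ) → ℕ
∥ a ∥₁ = sumℕ (λ i → ∣ a i ∣)

lowerTerms : (k : ℕ) → (Fin k → ℤ) → ℕ → ℤ
lowerTerms k a n = sumℤ (λ i → a i ℤ.* (+ n) ℤ.^ toℕ i)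

leadingTerm≡ : ∀ c n k → (+ c) ℤ.* (+ n) ℤ.^ k ≡ + (c * n ^ k)
leadingTerm≡ c n k = trans (cong ((+ c) ℤ.*_) (pos-^ n k)) (sym (ℤ.pos-* c (n ^ k)))

poly≡ : ∀ k c a n → poly k c a n ≡ + (c * n ^ k) ℤ.+ lowerTerms k a n
poly≡ k c a n = cong (ℤ._+ lowerTerms k a n) (leadingTerm≡ c n k)

∣lowerTerms∣≤ : ∀ {k} (a : Fin (suc k) → ℤ) n .{{_ : NonZero n}} →
  ∣ lowerTerms (suc k) a n ∣ ≤ ∥ a ∥₁ * n ^ k
∣lowerTerms∣≤ {k} a n = begin
  ∣ lowerTerms (suc k) a n ∣                  ≤⟨ ∣sumℤ∣≤sumℕ∣∣ (λ i → a i ℤ.* (+ n) ℤ.^ toℕ i) ⟩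
  sumℕ (λ i → ∣ a i ℤ.* (+ n) ℤ.^ toℕ i ∣)  ≤⟨ sumℕ-mono-≤ term≤ ⟩
  sumℕ (λ i → ∣ a i ∣ * n ^ k)               ≡⟨ sumℕ-distribʳ-* (λ i → ∣ a i ∣) (n ^ k) ⟩
  ∥ a ∥₁ * n ^ k                              ∎
  where
  open ≤-Reasoning
  term≤ : ∀ i → ∣ a i ℤ.* (+ n) ℤ.^ toℕ i ∣ ≤ ∣ a i ∣ * n ^ k
  term≤ i = begin
    ∣ a i ℤ.* (+ n) ℤ.^ toℕ i ∣   ≡⟨ ℤ.abs-* (a i) _ ⟩
    ∣ a i ∣ * ∣ (+ n) ℤ.^ toℕ i ∣  ≡⟨ cong (λ j → ∣ a i ∣ * ∣ j ∣) (pos-^ n (toℕ i)) ⟩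
    ∣ a i ∣ * n ^ toℕ i            ≤⟨ *-monoʳ-≤ ∣ a i ∣ (^-monoʳ-≤ n (Fin.toℕ≤pred[n] i)) ⟩
    ∣ a i ∣ * n ^ k                ∎

leading-<-poly : ∀ {k c r d n} (a : Fin (suc k) → ℤ) → ∥ a ∥₁ ℕ.< suc r * c → d + suc r ≤ n →
  + (c * d ^ suc k) ℤ.< poly (suc k) c a n
leading-<-poly {k} {c} {r} {d} {n} a S<[1+r]c d+1+r≤n =
  subst (+ (c * d ^ suc k) ℤ.<_) (sym (poly≡ (suc k) c a n))
    (ℤ.<-≤-trans (ℤ.+<+ (n<1+n _)) (m+∣i∣≤n⇒+m≤+n+i (lowerTerms (suc k) a n) gap))
  where
  open ≤-Reasoning
  d≤n : d ≤ n
  d≤n = ≤-trans (m≤m+n d (suc r)) d+1+r≤n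
  instance
    n≢0 : NonZero n
    n≢0 = >-nonZero (≤-trans (s≤s z≤n) (≤-trans (m≤n+m (suc r) d) d+1+r≤n))
    nᵏ≢0 : NonZero (n ^ k)
    nᵏ≢0 = m^n≢0 n k
  gap : c * d ^ suc k + ∣ lowerTerms (suc k) a n ∣ ℕ.< c * n ^ suc k
  gap = begin-strict
    c * (d * d ^ k) + ∣ lowerTerms (suc k) a n ∣
      ≤⟨ +-mono-≤ (*-monoʳ-≤ c (*-monoʳ-≤ d (^-monoˡ-≤ k d≤n))) (∣lowerTerms∣≤ a n) ⟩
    c * (d * n ^ k) + ∥ a ∥₁ * n ^ k
      <⟨ leading-term-dominates d (n ^ k) S<[1+r]c d+1+r≤n ⟩
    c * (n * n ^ k) ∎

poly-<-leading : ∀ {k c r n m} (a : Fin (suc k) → ℤ) .{{_ : NonZero n}} → ∥ a ∥₁ ℕ.< suc r * c →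
  n + suc r ≤ m → poly (suc k) c a n ℤ.< + (c * m ^ suc k)
poly-<-leading {k} {c} {r} {n} {m} a S<[1+r]c n+1+r≤m =
  subst (ℤ._< + (c * m ^ suc k)) (sym (poly≡ (suc k) c a n))
    (ℤ.≤-<-trans (+n+i≤+[n+∣i∣] (c * n ^ suc k) (lowerTerms (suc k) a n)) (ℤ.+<+ gap))
  where
  open ≤-Reasoning
  n≤m : n ≤ m
  n≤m = ≤-trans (m≤m+n n (suc r)) n+1+r≤m
  nᵏ≤mᵏ : n ^ k ≤ m ^ k
  nᵏ≤mᵏ = ^-monoˡ-≤ k n≤m
  instance
    mᵏ≢0 : NonZero (m ^ k)
    mᵏ≢0 = m^n≢0 m k {{>-nonZero (<-≤-trans (>-nonZero⁻¹ n) n≤m)}}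
  gap : c * n ^ suc k + ∣ lowerTerms (suc k) a n ∣ ℕ.< c * m ^ suc k
  gap = begin-strict
    c * (n * n ^ k) + ∣ lowerTerms (suc k) a n ∣
      ≤⟨ +-mono-≤ (*-monoʳ-≤ c (*-monoʳ-≤ n nᵏ≤mᵏ))
                  (≤-trans (∣lowerTerms∣≤ a n) (*-monoʳ-≤ ∥ a ∥₁ nᵏ≤mᵏ)) ⟩
    c * (n * m ^ k) + ∥ a ∥₁ * m ^ k
      <⟨ leading-term-dominates n (m ^ k) S<[1+r]c n+1+r≤m ⟩
    c * (m * m ^ k) ∎

module Windows (k c : ℕ) .{{_ : NonZero c}} (a : Fin (suc k) → ℤ) (x : ℚ) (0<x : 0ℚ < x) where

  r : ℕ
  r = floorR (suc k) c a

  ∥a∥₁<[1+r]c : ∥ a ∥₁ ℕ.< suc r * c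
  ∥a∥₁<[1+r]c = m<[1+m/n]*n ∥ a ∥₁ c

  Below : Pred ℕ _
  Below n = + (c * n ^ suc k) ℚ./ 1 ℚ.≤ x

  Below-0 : Below 0
  Below-0 = subst (λ m → + m ℚ./ 1 ℚ.≤ x) (sym (*-zeroʳ c)) (ℚ.<⇒≤ 0<x)

  Below-antitone : ∀ {m n} → m ≤ n → Below n → Below m
  Below-antitone m≤n = ℚ.≤-trans (/1-mono-≤ (ℤ.+≤+ (*-monoʳ-≤ c (^-monoˡ-≤ (suc k) m≤n))))

  unbounded : ∃[ b ] ¬ Below b
  unbounded with archimedean x
  ... | b , x<b = b , λ Bb →
    ℚ.<-irrefl refl (ℚ.<-≤-trans x<b (ℚ.≤-trans (/1-mono-≤ (ℤ.+≤+ (m≤n*m^[1+k] b c k))) Bb))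

  threshold : ∃[ N ] Below N × ¬ Below (suc N)
  threshold = crossing (λ n → _ ℚ.≤? x) Below-0 (proj₁ unbounded) (proj₂ unbounded)

  N : ℕ
  N = proj₁ threshold

  Below-N : Below N
  Below-N = proj₁ (proj₂ threshold)

  ¬Below-1+N : ¬ Below (suc N)
  ¬Below-1+N = proj₂ (proj₂ threshold)

  ≤N⇒Below : ∀ {n} → n ≤ N → Below n
  ≤N⇒Below n≤N = Below-antitone n≤N Below-N

  Below⇒≤N : ∀ {n} → Below n → n ≤ N
  Below⇒≤N Bn = ≮⇒≥ (λ N<n → ¬Below-1+N (Below-antitone N<n Bn))

  InB⇒Below : ∀ {n} → InB (suc k) c x n → Below n
  InB⇒Below {n} (_ , B) = subst (λ i → i ℚ./ 1 ℚ.≤ x) (leadingTerm≡ c n (suc k)) B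

  Below⇒InB : ∀ {n} → 1 ≤ n → Below n → InB (suc k) c x n
  Below⇒InB {n} 1≤n Bn = 1≤n , subst (λ i → i ℚ./ 1 ℚ.≤ x) (sym (leadingTerm≡ c n (suc k))) Bn

  h : ℕ → ℤ
  h = poly (suc k) c a

  leading-<-h : ∀ {d n} → d + suc r ≤ n → + (c * d ^ suc k) ℤ.< h n
  leading-<-h = leading-<-poly a ∥a∥₁<[1+r]c

  h-<-leading : ∀ {n m} .{{_ : NonZero n}} → n + suc r ≤ m → h n ℤ.< + (c * m ^ suc k)
  h-<-leading = poly-<-leading a ∥a∥₁<[1+r]c

  A∖B⇒Interval : ∀ {n} → InA (suc k) c a x n → ¬ InB (suc k) c x n → Interval (suc N) (suc r) n
  A∖B⇒Interval {n} (1≤n , _ , h<x) ∉B = ≰⇒> (λ n≤N → ∉B (Below⇒InB 1≤n (≤N⇒Below n≤N))) , ≰⇒> far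
    where
    far : ¬ (suc N + suc r ≤ n)
    far le = ¬Below-1+N (ℚ.<⇒≤ (ℚ.<-trans (/1-mono-< (leading-<-h le)) h<x))

  nonpositive⇒Interval : ∀ {n} → 1 ≤ n → ¬ (+ 0 ℤ.< h n) → Interval 1 r n
  nonpositive⇒Interval {n} 1≤n h≯0 =
    1≤n , ≰⇒> (λ r<n → h≯0 (subst (ℤ._< h n) (cong +_ (*-zeroʳ c)) (leading-<-h {d = 0} r<n)))

  B∖A∧positive⇒Interval : ∀ {n} → InB (suc k) c x n → + 0 ℤ.< h n → ¬ InA (suc k) c a x n →
    Interval (N ∸ r) (suc r) n
  B∖A∧positive⇒Interval {n} B@(1≤n , _) h>0 ∉A = Interval-below (Below⇒≤N (InB⇒Below B)) (≰⇒> near)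
    where
    instance
      n≢0 : NonZero n
      n≢0 = >-nonZero 1≤n
    near : ¬ (n + suc r ≤ N)
    near le = ∉A (1≤n , h>0 , ℚ.<-≤-trans (/1-mono-< (h-<-leading le)) Below-N)

  InSymDiff⊆Intervals : InSymDiff (suc k) c a x ⊆
    Interval 1 r ∪ (Interval (suc N) (suc r) ∪ Interval (N ∸ r) (suc r))
  InSymDiff⊆Intervals (inj₁ (A , ∉B)) = inj₂ (inj₁ (A∖B⇒Interval A ∉B))
  InSymDiff⊆Intervals {n} (inj₂ (B@(1≤n , _) , ∉A)) with + 0 ℤ.<? h n
  ... | no  h≯0 = inj₁ (nonpositive⇒Interval 1≤n h≯0)
  ... | yes h>0 = inj₂ (inj₂ (B∖A∧positive⇒Interval B h>0 ∉A))

proposition1 : (k : ℕ) → 1 ≤ k → (c : ℕ) → .{{_ : NonZero c}} → (a : Fin k → ℤ) →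
    (x : ℚ) → 0ℚ < x →
      CardLe (InSymDiff k c a x) (3 * floorR k c a + 2)
proposition1 (suc k) (s≤s z≤n) c a x 0<x =
  CardLe-≤ (≤-reflexive (r+[[1+r]+[1+r]]≡3r+2 r)) (CardLe-⊆ InSymDiff⊆Intervals
    (CardLe-∪ (Interval? 1 r) (CardLe-Interval 1 r)
      (CardLe-∪ (Interval? (suc N) (suc r)) (CardLe-Interval (suc N) (suc r))
                (CardLe-Interval (N ∸ r) (suc r)))))
  where
  open Windows k c a x 0<x
  open +-*-Solver
  r+[[1+r]+[1+r]]≡3r+2 : ∀ r → r + (suc r + suc r) ≡ 3 * r + 2
  r+[[1+r]+[1+r]]≡3r+2 = solve 1 (λ r → r :+ ((con 1 :+ r) :+ (con 1 :+ r)) := con 3 :* r :+ con 2) refl
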